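{- Let $u$ and $v$ be sets and $r\subseteq v\times u$ a total relation (every $y\in v$ is related to some $x\in u$). Let $F,G$ be conjunctive set transformers on $\mathbb{P}(u)$ with $F(u)=u$, $G(u)=u$, and let $p,q\subseteq u$ satisfy $p\cap\overline{q}\subseteq F(p\cup q)$, $p\cap\overline{q}\subseteq\mathsf{grd}(G)$ and $p\cap\overline{q}\subseteq G(q)$. Let $F',G',H$ be conjunctive set transformers on $\mathbb{P}(v)$ such that for every $s\subseteq v$: $F(\overline{r[\overline{s}]})\subseteq\overline{r[\overline{F'(s)}]}$, $G(\overline{r[\overline{s}]})\subseteq\overline{r[\overline{G'(s)}]}$ and $\overline{r[\overline{s}]}\subseteq\overline{r[\overline{H(s)}]}$. Let $p'=r^{ -1}[p]$, $q'=r^{ -1}[q]$, and let $X'(q')$ be the fair iteration defined recursively by $$X'(q')=\overline{q'}\Longrightarrow\big(((F'\,[\!]\,H)\,;\,X'(q'))\mathrel{\triangledown}G'\big).$$ Then $p'\cup q'\subseteq\mathcal{L}(X'(q'))(q')$.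
   Context: A set transformer on a set $w$ is a map $\mathbb{P}(w)\to\mathbb{P}(w)$; it is conjunctive if it distributes over (nonempty) intersections, hence is monotone. Complements are taken in the relevant space ($\overline a=u\setminus a$ for $a\subseteq u$, $\overline a=v\setminus a$ for $a\subseteq v$). For $a\subseteq v$, $r[a]=\{x\in u\mid\exists y\in a,\ (y,x)\in r\}$, and for $b\subseteq u$, $r^{ -1}[b]=\{y\in v\mid\exists x\in b,\ (y,x)\in r\}$. For a set transformer $S$: $\mathsf{pre}(S)=S(\text{whole space})$ and $\mathsf{grd}(S)=\overline{S(\varnothing)}$. Each set transformer $S$ has a liberal set transformer $\mathcal{L}(S)$, related by the pairing condition $S(t)=\mathcal{L}(S)(t)\cap\mathsf{pre}(S)$; if $S$ of the whole space is the whole space then $S=\mathcal{L}(S)$. Operators: $(S\,[\!]\,T)(t)=S(t)\cap T(t)$, $\mathcal{L}(S\,[\!]\,T)(t)=\mathcal{L}(S)(t)\cap\mathcal{L}(T)(t)$; $(S;T)(t)=S(T(t))$, $\mathcal{L}(S;T)(t)=\mathcal{L}(S)(\mathcal{L}(T)(t))$; for a subset $a$: $(a\Longrightarrow S)(t)=\overline{a}\cup S(t)$, $\mathcal{L}(a\Longrightarrow S)(t)=\overline a\cup\mathcal{L}(S)(t)$; $(a\,|\,S)(t)=a\cap S(t)$. Dovetail operator: $\mathcal{L}(S\mathrel{\triangledown}T)(t)=\mathcal{L}(S)(t)\cap\mathcal{L}(T)(t)$, $\mathsf{pre}(S\mathrel{\triangledown}T)=(\mathsf{pre}(S)\cap \mathsf{pre}(T))\cup(\mathsf{grd}(S)\cap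 \mathsf{pre}(S))\cup(\mathsf{grd}(T)\cap \mathsf{pre}(T))$, and $(S\mathrel{\triangledown}T)(t)=\mathcal{L}(S\mathrel{\triangledown}T)(t)\cap\mathsf{pre}(S\mathrel{\triangledown}T)$. For recursively defined transformers, the set transformer is the least fixpoint and the liberal set transformer the greatest fixpoint of the monotone function obtained by unfolding the recursive equation with these rules. (The three inclusions on $F',G',H$ express that $F'$ refines $F$, $G'$ refines $G$ and $H$ refines skip via the gluing relation $r$.) -}

module Defs where

open import Level using (0ℓ)
open import Data.Product using (Σ; ∃; _×_; _,_)
open import Relation.Unary using (Pred; _⊆_; _∪_; _∩_; ∁; ⋂; _≐_)

Subset : Set → Set₁
Subset u = Pred u 0ℓ

Transformer : Set → Set₁
Transformer u = Subset u → Subset u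

-- Set transformers act on sets, so they respect extensional equality of subsets.
Extensional : {u : Set} → Transformer u → Set₁
Extensional {u} S = (a b : Subset u) → a ≐ b → S a ≐ S b

Conjunctive : {u : Set} → Transformer u → Set₁
Conjunctive {u} S =
  Extensional S ×
  ((I : Set) → I → (f : I → Subset u) → S (⋂ I f) ≐ ⋂ I (λ i → S (f i)))

-- Relational image and inverse image of r ⊆ v × u  (r y x means (y,x) ∈ r).
Rel : Set → Set → Set₁
Rel v u = v → u → Set

img : {v u : Set} → Rel v u → Subset v → Subset u
img r a = λ x → ∃ λ y → a y × r y x

invImg : {v u : Set} → Rel v u → Subset u → Subset v
invImg r b = λ y → ∃ λ x → b x × r y x

Total : {v u : Set} → Rel v u → Set
Total {v} {u} r = (y : v) → ∃ λ x → r y x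

grd : {u : Set} → Transformer u → Subset u
grd S = ∁ (S (λ _ → Data.Empty.⊥))
  where import Data.Empty

-- Liberal-transformer semantics of the operators.
Lchoice : {v : Set} → Transformer v → Transformer v → Transformer v
Lchoice LS LT t = LS t ∩ LT t

Lseq : {v : Set} → Transformer v → Transformer v → Transformer v
Lseq LS LT t = LS (LT t)

Lguard : {v : Set} → Subset v → Transformer v → Transformer v
Lguard a LS t = ∁ a ∪ LS t

Ldovetail : {v : Set} → Transformer v → Transformer v → Transformer v
Ldovetail LS LT t = LS t ∩ LT t

-- Unfolding of  X' = ¬q' ⟹ (((F' [] H) ; X') ▽ G')  at the liberal level,
-- given the liberal transformers LF', LH, LG' of F', H, G'.
fairΦ : {v : Set} → Subset v → Transformer v → Transformer v → Transformer v →
        Transformer v → Transformer v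
fairΦ q' LF' LH LG' Y =
  Lguard (∁ q') (Ldovetail (Lseq (Lchoice LF' LH) Y) LG')

-- Greatest fixpoint (Knaster–Tarski: union of all post-fixpoints, pointwise order).
gfp : {v : Set} → (Transformer v → Transformer v) → Subset v → Pred v (Level.suc 0ℓ)
gfp {v} Φ t = λ y → Σ (Transformer v) λ Y → ((s : Subset v) → Y s ⊆ Φ Y s) × Y t y
  where import Level

LX' : {v : Set} → Subset v → Transformer v → Transformer v → Transformer v →
      Subset v → Pred v (Level.suc 0ℓ)
LX' q' LF' LH LG' = gfp (fairΦ q' LF' LH LG')
  where import Level

{-# OPTIONS --safe #-}

-- The set  a := p' ∪ q'  is an invariant of the fair iteration: taking Y s := a when q' ⊆ s
-- and Y s := ∅ otherwise gives a post-fixpoint of the unfolding of L(X'(q')), because every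
-- point of a ∖ q' is glued to some x ∈ p ∖ q, where F, skip and G take the required steps
-- by hypothesis.  The refinement inclusions transport these steps along r to F', H and G',
-- and the pairing condition lifts them to the liberal transformers.
module Submission where

open import Defs
open import Level using (0ℓ)
open import Axiom.ExcludedMiddle using (ExcludedMiddle)
open import Relation.Unary using (_⊆_; _∪_; _∩_; ∁; _≐_; U; ⋂)
open import Relation.Binary.Core using (_Preserves_⟶_)
open import Relation.Nullary using (yes; no)
open import Relation.Nullary.Decidable using (decidable-stable)
open import Data.Bool using (Bool; true; false; if_then_else_)
open import Data.Product using (_×_; _,_; proj₁)
open import Data.Sum using (inj₁; inj₂)
open import Data.Empty using (⊥-elim)
open import Function using (id; _∘_)

private
  variable
    u v : Set
    a b : Subset u

Monotone : Transformer u → Set₁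
Monotone S = S Preserves _⊆_ ⟶ _⊆_

conjunctive⇒monotone : {S : Transformer u} → Conjunctive S → Monotone S
conjunctive⇒monotone {u} {S} (resp , ⋂-distrib) {a} {b} a⊆b =
  (λ Sa∩Sb → Sa∩Sb false) ∘ proj₁ (⋂-distrib Bool true pair)
  ∘ proj₁ (resp a (⋂ Bool pair) a≐a∩b)
  where
  pair : Bool → Subset u
  pair i = if i then a else b
  a≐a∩b : a ≐ ⋂ Bool pair
  a≐a∩b = (λ { ax true → ax ; ax false → a⊆b ax }) , (λ a∩b → a∩b true)

⊆-liberal : {S L : Transformer u} → ((t : Subset u) → S t ≐ L t ∩ S U) →
            (t : Subset u) → S t ⊆ L t
⊆-liberal paired t = proj₁ ∘ proj₁ (paired t)

gfp-coinduction : {Φ : Transformer v → Transformer v} {Y : Transformer v} →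
                  ((s : Subset v) → Y s ⊆ Φ Y s) → (t : Subset v) → Y t ⊆ gfp Φ t
gfp-coinduction {Y = Y} post t y = Y , post , y

module _ (r : Rel v u) where

  box : Subset v → Subset u
  box s = ∁ (img r (∁ s))

  box-elim : ExcludedMiddle 0ℓ → {s : Subset v} {x : u} {z : v} → box s x → r z x → s z
  box-elim em {s = s} {z = z} □sx rzx =
    decidable-stable (em {s z}) (λ ¬sz → □sx (z , ¬sz , rzx))

  ⊆-box-invImg : a ⊆ box (invImg r a)
  ⊆-box-invImg ax (_ , ¬z∈r⁻¹a , rzx) = ¬z∈r⁻¹a (_ , ax , rzx)

  invImg-mono : a ⊆ b → invImg r a ⊆ invImg r b
  invImg-mono a⊆b (x , ax , rzx) = x , a⊆b ax , rzx

  invImg-∪ : invImg r (a ∪ b) ⊆ invImg r a ∪ invImg r b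
  invImg-∪ (x , inj₁ ax , rzx) = inj₁ (x , ax , rzx)
  invImg-∪ (x , inj₂ bx , rzx) = inj₂ (x , bx , rzx)

  invImg-∪-∖ : (invImg r a ∪ invImg r b) ∩ ∁ (invImg r b) ⊆ invImg r (a ∩ ∁ b)
  invImg-∪-∖ (inj₁ (x , ax , rzx) , z∉r⁻¹b) =
    x , (ax , λ bx → z∉r⁻¹b (x , bx , rzx)) , rzx
  invImg-∪-∖ (inj₂ z∈r⁻¹b , z∉r⁻¹b) = ⊥-elim (z∉r⁻¹b z∈r⁻¹b)

  invImg-refines : ExcludedMiddle 0ℓ → {S : Transformer u} {S' : Transformer v} →
                   Monotone S → ((s : Subset v) → S (box s) ⊆ box (S' s)) →
                   (b : Subset u) → invImg r (S b) ⊆ S' (invImg r b)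
  invImg-refines em S-mono refines b (_ , Sbx , rzx) =
    box-elim em (refines (invImg r b) (S-mono ⊆-box-invImg Sbx)) rzx

fair-invariant : ExcludedMiddle 0ℓ → {q' a : Subset v} {LF' LH LG' : Transformer v} →
                 Monotone LF' → Monotone LH → Monotone LG' →
                 a ∩ ∁ q' ⊆ LF' a → a ∩ ∁ q' ⊆ LH a → a ∩ ∁ q' ⊆ LG' q' →
                 a ⊆ LX' q' LF' LH LG' q'
fair-invariant {v} em {q'} {a} {LF'} {LH} {LG'} LF'-mono LH-mono LG'-mono stepF stepH stepG az =
  gfp-coinduction post q' (id , az)
  where
  Y : Transformer v
  Y s z = q' ⊆ s × a z
  post : (s : Subset v) → Y s ⊆ fairΦ q' LF' LH LG' Y s
  post s {z} (q'⊆s , az) with em {q' z}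
  ... | yes q'z = inj₁ (λ ¬q'z → ¬q'z q'z)
  ... | no ¬q'z = inj₂ ( ( LF'-mono a⊆Ys (stepF (az , ¬q'z))
                         , LH-mono a⊆Ys (stepH (az , ¬q'z)) )
                       , LG'-mono q'⊆s (stepG (az , ¬q'z)) )
    where
    a⊆Ys : a ⊆ Y s
    a⊆Ys = q'⊆s ,_

lemma5 : ExcludedMiddle 0ℓ →
    (u v : Set) (r : Rel v u) → Total r →
    (F G : Transformer u) → Conjunctive F → Conjunctive G →
    F U ≐ U → G U ≐ U →
    (p q : Subset u) →
    p ∩ ∁ q ⊆ F (p ∪ q) → p ∩ ∁ q ⊆ grd G → p ∩ ∁ q ⊆ G q →
    (F' G' H LF' LG' LH : Transformer v) →
    Conjunctive F' → Conjunctive G' → Conjunctive H →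
    Conjunctive LF' → Conjunctive LG' → Conjunctive LH →
    ((t : Subset v) → F' t ≐ LF' t ∩ F' U) →
    ((t : Subset v) → G' t ≐ LG' t ∩ G' U) →
    ((t : Subset v) → H t ≐ LH t ∩ H U) →
    ((s : Subset v) → F (∁ (img r (∁ s))) ⊆ ∁ (img r (∁ (F' s)))) →
    ((s : Subset v) → G (∁ (img r (∁ s))) ⊆ ∁ (img r (∁ (G' s)))) →
    ((s : Subset v) → ∁ (img r (∁ s)) ⊆ ∁ (img r (∁ (H s)))) →
    invImg r p ∪ invImg r q ⊆ LX' (invImg r q) LF' LH LG' (invImg r q)
lemma5 em u v r _ F G F-conj G-conj _ _ p q p∖q⊆F _ p∖q⊆Gq F' G' H LF' LG' LH
       F'-conj _ H-conj LF'-conj LG'-conj LH-conj F'-paired G'-paired H-paired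
       F⊑F' G⊑G' skip⊑H =
  fair-invariant em (mono LF'-conj) (mono LH-conj) (mono LG'-conj) stepF stepH stepG
  where
  mono : {w : Set} {S : Transformer w} → Conjunctive S → Monotone S
  mono = conjunctive⇒monotone
  p' q' : Subset v
  p' = invImg r p
  q' = invImg r q
  stepF : (p' ∪ q') ∩ ∁ q' ⊆ LF' (p' ∪ q')
  stepF = ⊆-liberal F'-paired _ ∘ mono F'-conj (invImg-∪ r)
        ∘ invImg-refines r em (mono F-conj) F⊑F' (p ∪ q)
        ∘ invImg-mono r p∖q⊆F ∘ invImg-∪-∖ r
  stepH : (p' ∪ q') ∩ ∁ q' ⊆ LH (p' ∪ q')
  stepH = ⊆-liberal H-paired _ ∘ mono H-conj (invImg-∪ r)
        ∘ invImg-refines r em {S = id} id skip⊑H (p ∪ q)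
        ∘ invImg-mono r (inj₁ ∘ proj₁) ∘ invImg-∪-∖ r
  stepG : (p' ∪ q') ∩ ∁ q' ⊆ LG' q'
  stepG = ⊆-liberal G'-paired _
        ∘ invImg-refines r em (mono G-conj) G⊑G' q
        ∘ invImg-mono r p∖q⊆Gq ∘ invImg-∪-∖ r
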